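{- For every class $\mathcal C$ of graphs of bounded shrubdepth there exists a constant $p\in\mathbb N$ such that the following holds. Suppose $G\in\mathcal C$ and $A$ and $B$ are two disjoint subsets of vertices of $G$ such that every vertex of $A$ has a neighbor in $B$. Then there is a function $f\colon A\to B$ which is $p$-guidable as a partial function on $G$.
   Context: Graphs are finite, simple, undirected. Shrubdepth: a connection model with labels from $\Lambda$ is a rooted tree with leaf labels $\lambda(x)\in\Lambda$ and symmetric relations $C(v)\subseteq\Lambda^2$ at internal nodes, defining the graph on leaves where distinct $x,y$ are adjacent iff $(\lambda(x),\lambda(y))\in C(\mathrm{lca}(x,y))$; a class has bounded shrubdepth if for some $h$ and finite $\Lambda$ each member has such a model of depth at most $h$ with labels in $\Lambda$. A guidance system in $G$ is a family $\mathcal U$ of subsets of $V(G)$, of size $|\mathcal U|$. A partial function $f\colon V(G)\rightharpoonup V(G)$ is guided by $\mathcal U$ if for every $x$ with $f(x)$ defined and $f(x)\neq x$ there is $U\in\mathcal U$ such that $f(x)$ is the unique neighbor of $x$ in $U$; $f$ is $p$-guidable if it is guided by some guidance system of size at most $p$. A function $f\colon A\to B$ is regarded as a partial function on $V(G)$ defined exactly on $A$. -}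

module Defs where

open import Level using (Level; _⊔_) renaming (suc to lsuc)
open import Data.Nat using (ℕ; zero; suc; _≤_)
open import Data.Fin using (Fin; _≟_)
open import Data.Fin.Subset using (Subset; _∈_; _∉_)
open import Data.Bool using (Bool; true; false)
open import Data.Unit using (⊤; tt)
open import Data.Empty using (⊥)
open import Data.Maybe using (Maybe; just; nothing)
open import Data.List using (List; length)
open import Data.List.Relation.Unary.Any using (Any)
open import Data.Product using (Σ; ∃; _×_; _,_)
open import Function.Bundles using (_↔_; _⇔_; Inverse)
open import Relation.Nullary using (¬_; yes; no)
open import Relation.Binary.PropositionalEquality using (_≡_; _≢_; refl)

record Graph : Set where
  field
    n      : ℕ
    adj    : Fin n → Fin n → Bool
    sym    : ∀ x y → adj x y ≡ adj y x
    irrefl : ∀ x → adj x x ≡ false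

V : Graph → Set
V G = Fin (Graph.n G)

Adj : (G : Graph) → V G → V G → Set
Adj G x y = Graph.adj G x y ≡ true

-- Connection models with labels from Λ = Fin L.
-- An internal node carries a symmetric relation C ⊆ Λ² (as a Bool matrix)
-- and a finite family of k children.

data CM (L : ℕ) : Set where
  leaf : Fin L → CM L
  node : (C : Fin L → Fin L → Bool) → (∀ a b → C a b ≡ C b a) →
         (k : ℕ) → (Fin k → CM L) → CM L

Leaf : ∀ {L} → CM L → Set
Leaf (leaf a) = ⊤
Leaf (node C s k ts) = Σ (Fin k) λ i → Leaf (ts i)

label : ∀ {L} (t : CM L) → Leaf t → Fin L
label (leaf a) _ = a
label (node C s k ts) (i , p) = label (ts i) p

-- graph on the leaves: x ~ y iff (λ x, λ y) ∈ C(lca x y)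
-- (recursion descends while x and y lie in the same child subtree;
--  at the lca they lie in distinct children i ≢ j)
ModelAdj : ∀ {L} (t : CM L) → Leaf t → Leaf t → Set
ModelAdj (leaf a) _ _ = ⊥
ModelAdj (node C s k ts) (i , p) (j , q) with i ≟ j
... | yes refl = ModelAdj (ts i) p q
... | no _ = C (label (ts i) p) (label (ts j) q) ≡ true

Depth≤ : ∀ {L} → ℕ → CM L → Set
Depth≤ h (leaf a) = ⊤
Depth≤ zero (node C s k ts) = ⊥
Depth≤ (suc h) (node C s k ts) = ∀ i → Depth≤ h (ts i)

IsModelOf : ∀ {L} → CM L → Graph → Set
IsModelOf t G =
  Σ (V G ↔ Leaf t) λ φ →
    ∀ x y → x ≢ y → (Adj G x y ⇔ ModelAdj t (Inverse.to φ x) (Inverse.to φ y))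

BoundedShrubdepth : ∀ {ℓ} → (Graph → Set ℓ) → Set ℓ
BoundedShrubdepth 𝒞 =
  Σ ℕ λ h → Σ ℕ λ L → ∀ G → 𝒞 G →
    Σ (CM L) λ t → Depth≤ h t × IsModelOf t G

GuidanceSystem : Graph → Set
GuidanceSystem G = List (Subset (Graph.n G))

PartialFun : Graph → Set
PartialFun G = V G → Maybe (V G)

UniqueNeighbourIn : (G : Graph) → V G → Subset (Graph.n G) → V G → Set
UniqueNeighbourIn G x U y =
  y ∈ U × Adj G x y × (∀ z → z ∈ U → Adj G x z → z ≡ y)

GuidedBy : (G : Graph) → PartialFun G → GuidanceSystem G → Set
GuidedBy G f 𝒰 =
  ∀ x y → f x ≡ just y → y ≢ x → Any (λ U → UniqueNeighbourIn G x U y) 𝒰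

Guidable : (G : Graph) → ℕ → PartialFun G → Set
Guidable G p f = Σ (GuidanceSystem G) λ 𝒰 → length 𝒰 ≤ p × GuidedBy G f 𝒰

-- the partial function f is (the partial function induced by) a function A → B
IsFunctionFromTo : (G : Graph) → Subset (Graph.n G) → Subset (Graph.n G) →
                   PartialFun G → Set
IsFunctionFromTo G A B f =
  (∀ x → x ∈ A → Σ (V G) λ y → f x ≡ just y × y ∈ B) ×
  (∀ x → x ∉ A → f x ≡ nothing)

module Submission where

-- The whole argument happens inside a connection model t of depth ≤ h with
-- L labels.  For a set B of leaves call a family 𝒰 of subsets of B a
-- guidance family for B if every leaf x with a neighbour in B has, for some
-- U ∈ 𝒰, a unique neighbour in U.  We show (modelGuidance) that every B has
-- a guidance family of size h·2L, by induction on the depth.  At a root with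
-- children T₁ … T_k, a leaf x either
--   * has a neighbour z ∈ B in another child; then adjacency to x depends
--     only on the label b of z, and one of two representatives of label b in
--     B (the second one chosen in a child different from the first) lies
--     outside x's child, so its singleton guides x: 2L singletons suffice;
--   * or all its B-neighbours lie in its own child T_i; then the family of
--     T_i, glued across the children index-wise, guides x.
-- Finally the leaves are transported to the vertices of G along the
-- bijection of the model, and f sends x ∈ A to its guided neighbour in B.

open import Defs
open import Data.Nat using (ℕ; zero; suc; _+_; _*_)
open import Data.Nat.Properties using (≤-reflexive)
open import Data.Fin using (Fin; _≟_; _↑ˡ_; _↑ʳ_)
open import Data.Fin.Properties using (any?)
open import Data.Fin.Subset using (Subset; _∈_; _∉_)
open import Data.Fin.Subset.Properties using (_∈?_)
open import Data.Product using (Σ; _×_; _,_; proj₁; proj₂)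
open import Data.Product.Properties using (≡-dec)
open import Data.Sum using (_⊎_; inj₁; inj₂)
open import Data.Bool using (Bool; true; false)
import Data.Bool as Bool
open import Data.Unit using (tt)
open import Data.Empty using (⊥-elim)
open import Data.Maybe using (just; nothing)
import Data.List as List
open import Data.List.Properties using (length-tabulate)
open import Data.List.Relation.Unary.Any.Properties using (tabulate⁺)
open import Data.Vec using (lookup)
import Data.Vec as Vec
open import Data.Vec.Properties using (lookup∘tabulate; []=⇒lookup; lookup⇒[]=)
open import Data.Vec.Functional using (Vector; _++_)
open import Data.Vec.Functional.Properties using (lookup-++ˡ; lookup-++ʳ)
open import Data.Vec.Functional.Relation.Unary.Any using (Any)
open import Data.Vec.Functional.Relation.Unary.All using (All)
open import Data.Vec.Functional.Relation.Unary.All.Properties using (++⁺)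
open import Function.Bundles using (_↔_; _⇔_; Inverse; Equivalence; mk⇔)
open import Relation.Nullary using (¬_; Dec; yes; no)
open import Relation.Nullary.Decidable using (isYes; map′; _×-dec_; ¬?)
open import Relation.Unary using (Decidable)
open import Relation.Binary.Definitions using (DecidableEquality)
open import Relation.Binary.PropositionalEquality
  using (_≡_; _≢_; refl; sym; trans; cong; subst; ≢-sym)

module _ {A : Set} (P : A → Set) {m n : ℕ} (xs : Vector A m) (ys : Vector A n) where

  any-++ˡ : Any P xs → Any P (xs ++ ys)
  any-++ˡ (i , p) = i ↑ˡ n , subst P (sym (lookup-++ˡ xs ys i)) p

  any-++ʳ : Any P ys → Any P (xs ++ ys)
  any-++ʳ (i , p) = m ↑ʳ i , subst P (sym (lookup-++ʳ xs ys i)) p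

module Model {L : ℕ} where

  findLeaf : (t : CM L) {P : Leaf t → Set} → Decidable P → Dec (Σ (Leaf t) P)
  findLeaf (leaf a) P? = map′ (tt ,_) proj₂ (P? tt)
  findLeaf (node C s k ts) P? =
    map′ (λ { (i , q , p) → (i , q) , p }) (λ { ((i , q) , p) → i , q , p })
      (any? (λ i → findLeaf (ts i) (λ q → P? (i , q))))

  leaf-≟ : (t : CM L) → DecidableEquality (Leaf t)
  leaf-≟ (leaf a) tt tt = yes refl
  leaf-≟ (node C s k ts) = ≡-dec _≟_ (λ {i} → leaf-≟ (ts i))

  LeafSet : CM L → Set
  LeafSet t = Leaf t → Bool

  ∅ : ∀ t → LeafSet t
  ∅ t _ = false

  Within : ∀ t → LeafSet t → LeafSet t → Set
  Within t B U = ∀ z → U z ≡ true → B z ≡ true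

  UniqueNbr : (t : CM L) → Leaf t → LeafSet t → Leaf t → Set
  UniqueNbr t x U z =
    U z ≡ true × ModelAdj t x z × (∀ w → U w ≡ true → ModelAdj t x w → w ≡ z)

  Guided : (t : CM L) → Leaf t → LeafSet t → Set
  Guided t x U = Σ (Leaf t) (UniqueNbr t x U)

  record Guides {m : ℕ} (t : CM L) (B : LeafSet t) (𝒰 : Vector (LeafSet t) m) : Set where
    field
      inside : All (Within t B) 𝒰
      guide  : ∀ x y → B y ≡ true → ModelAdj t x y → Any (Guided t x) 𝒰
  open Guides

  Guidance : (t : CM L) → LeafSet t → ℕ → Set
  Guidance t B m = Σ (Vector (LeafSet t) m) (Guides t B)

  singleton : (t : CM L) → Leaf t → LeafSet t
  singleton t r z = isYes (leaf-≟ t z r)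

  singleton-≡ : ∀ t {r z} → singleton t r z ≡ true → z ≡ r
  singleton-≡ t {r} {z} e with leaf-≟ t z r
  singleton-≡ t e | yes z≡r = z≡r
  singleton-≡ t () | no _

  singletonGuides : ∀ {t x r} → ModelAdj t x r → UniqueNbr t x (singleton t r) r
  singletonGuides {t} {x} {r} xr = self , xr , λ w e _ → singleton-≡ t e
    where
    self : singleton t r r ≡ true
    self with leaf-≟ t r r
    ... | yes _ = refl
    ... | no r≢r = ⊥-elim (r≢r refl)

  chosen : ∀ t {P : Leaf t → Set} → Dec (Σ (Leaf t) P) → LeafSet t
  chosen t (yes (r , _)) = singleton t r
  chosen t (no _) = ∅ t

  chosen-within : ∀ t {B} {P : Leaf t → Set} → (∀ z → P z → B z ≡ true) →
                  (d : Dec (Σ (Leaf t) P)) → Within t B (chosen t d)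
  chosen-within t P⊆B (yes (r , pr)) z e = subst _ (sym (singleton-≡ t e)) (P⊆B r pr)
  chosen-within t P⊆B (no _) z ()

  module Root (C : Fin L → Fin L → Bool) (C-sym : ∀ a b → C a b ≡ C b a)
                  (k : ℕ) (ts : Fin k → CM L) where

    T : CM L
    T = node C C-sym k ts

    child : Leaf T → Fin k
    child = proj₁

    lab : Leaf T → Fin L
    lab = label T

    sameChild : ∀ i p q → ModelAdj T (i , p) (i , q) ⇔ ModelAdj (ts i) p q
    sameChild i p q with i ≟ i
    ... | yes refl = mk⇔ (λ a → a) (λ a → a)
    ... | no i≢i = ⊥-elim (i≢i refl)

    crossChild : ∀ {i j} → i ≢ j → ∀ p q →
                 ModelAdj T (i , p) (j , q) ⇔ (C (label (ts i) p) (label (ts j) q) ≡ true)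
    crossChild {i} {j} i≢j p q with i ≟ j
    ... | yes i≡j = ⊥-elim (i≢j i≡j)
    ... | no _ = mk⇔ (λ a → a) (λ a → a)

    labelAdj : ∀ x w {b} → child w ≢ child x → lab w ≡ b → C (lab x) b ≡ true →
               ModelAdj T x w
    labelAdj (i , p) (j , q) j≢i refl cb = Equivalence.from (crossChild (≢-sym j≢i) p q) cb

    module _ (B : LeafSet T) where

      Rep : Fin L → Leaf T → Set
      Rep b z = B z ≡ true × lab z ≡ b

      RepOutside : Fin L → Fin k → Leaf T → Set
      RepOutside b c z = Rep b z × child z ≢ c

      rep? : ∀ b → Dec (Σ (Leaf T) (Rep b))
      rep? b = findLeaf T (λ z → (B z Bool.≟ true) ×-dec (lab z ≟ b))

      repOutside? : ∀ b c → Dec (Σ (Leaf T) (RepOutside b c))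
      repOutside? b c = findLeaf T (λ z →
        ((B z Bool.≟ true) ×-dec (lab z ≟ b)) ×-dec ¬? (child z ≟ c))

      secondChoice : ∀ {b} → Dec (Σ (Leaf T) (Rep b)) → LeafSet T
      secondChoice {b} (yes (r , _)) = chosen T (repOutside? b (child r))
      secondChoice (no _) = ∅ T

      representatives : Vector (LeafSet T) (L + L)
      representatives = (λ b → chosen T (rep? b)) ++ (λ b → secondChoice (rep? b))

      representativesWithin : All (Within T B) representatives
      representativesWithin =
        ++⁺ (Within T B) (λ b → chosen-within T (λ _ → proj₁) (rep? b)) (λ b → secondWithin (rep? b))
        where
        secondWithin : ∀ {b} (d : Dec (Σ (Leaf T) (Rep b))) → Within T B (secondChoice d)
        secondWithin {b} (yes (r , _)) =
          chosen-within T (λ _ rep → proj₁ (proj₁ rep)) (repOutside? b (child r))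
        secondWithin (no _) z ()

      CrossNbr : Leaf T → Leaf T → Set
      CrossNbr x z = B z ≡ true × child z ≢ child x × C (lab x) (lab z) ≡ true

      crossNbr? : ∀ x → Dec (Σ (Leaf T) (CrossNbr x))
      crossNbr? x = findLeaf T (λ z →
        (B z Bool.≟ true) ×-dec (¬? (child z ≟ child x) ×-dec (C (lab x) (lab z) Bool.≟ true)))

      crossGuided : ∀ x z → CrossNbr x z → (d : Dec (Σ (Leaf T) (Rep (lab z)))) →
                    Guided T x (chosen T d) ⊎ Guided T x (secondChoice d)
      crossGuided x z (Bz , z-away , cz) (no noRep) = ⊥-elim (noRep (z , Bz , refl))
      crossGuided x z (Bz , z-away , cz) (yes (r , Br , lr)) with child r ≟ child x
      ... | no r-away = inj₁ (r , singletonGuides {T} {x} (labelAdj x r r-away lr cz))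
      ... | yes r-here with repOutside? (lab z) (child r)
      ...   | no noRep = ⊥-elim (noRep (z , (Bz , refl) , λ e → z-away (trans e r-here)))
      ...   | yes (r′ , (_ , lr′) , r′-away) =
        inj₂ (r′ , singletonGuides {T} {x} (labelAdj x r′ (λ e → r′-away (trans e (sym r-here))) lr′ cz))

      glue : ∀ {m} → (∀ i → Vector (LeafSet (ts i)) m) → Vector (LeafSet T) m
      glue ℱ j (i , q) = ℱ i j q

      module _ {m} (ℱ : ∀ i → Vector (LeafSet (ts i)) m)
               (ℱ-guides : ∀ i → Guides (ts i) (λ q → B (i , q)) (ℱ i)) where

        glueWithin : All (Within T B) (glue ℱ)
        glueWithin j (i , q) = inside (ℱ-guides i) j q

        innerGuided : ∀ i p q → B (i , q) ≡ true → ModelAdj (ts i) p q →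
                      ¬ Σ (Leaf T) (CrossNbr (i , p)) → Any (Guided T (i , p)) (glue ℱ)
        innerGuided i p q Bq pq noCross with guide (ℱ-guides i) p q Bq pq
        ... | j , z , Uz , pz , unique =
          j , (i , z) , Uz , Equivalence.from (sameChild i p z) pz , unique′
          where
          -- deciding i ≟ i′ also unfolds the root adjacency pw in each branch
          unique′ : ∀ w → glue ℱ j w ≡ true → ModelAdj T (i , p) w → w ≡ (i , z)
          unique′ (i′ , w) Uw pw with i ≟ i′
          ... | yes refl = cong (i ,_) (unique w Uw pw)
          ... | no i≢i′ = ⊥-elim (noCross ((i′ , w) , inside (ℱ-guides i′) j w Uw ,
                                   ≢-sym i≢i′ , pw))

      nodeGuidance : ∀ {m} → (∀ i → Guidance (ts i) (λ q → B (i , q)) m) →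
                     Guidance T B ((L + L) + m)
      nodeGuidance ℱ = representatives ++ glue family ,
        record { inside = ++⁺ (Within T B) representativesWithin (glueWithin family guides)
               ; guide = guideAll }
        where
        family : ∀ i → Vector (LeafSet (ts i)) _
        family i = proj₁ (ℱ i)
        guides : ∀ i → Guides (ts i) (λ q → B (i , q)) (family i)
        guides i = proj₂ (ℱ i)

        guideAll : ∀ x y → B y ≡ true → ModelAdj T x y →
                   Any (Guided T x) (representatives ++ glue family)
        guideAll x y By xy with crossNbr? x
        guideAll x y By xy | yes (z , cross) with crossGuided x z cross (rep? (lab z))
        ... | inj₁ g = any-++ˡ (Guided T x) representatives (glue family)
                         (any-++ˡ (Guided T x) (λ b → chosen T (rep? b)) _ (lab z , g))
        ... | inj₂ g = any-++ˡ (Guided T x) representatives (glue family)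
                         (any-++ʳ (Guided T x) (λ b → chosen T (rep? b)) (λ b → secondChoice (rep? b)) (lab z , g))
        guideAll (i , p) (j , q) By xy | no noCross with j ≟ i
        ... | yes refl = any-++ʳ (Guided T (i , p)) representatives (glue family)
                           (innerGuided family guides i p q By (Equivalence.to (sameChild i p q) xy) noCross)
        ... | no j≢i = ⊥-elim (noCross ((j , q) , By , j≢i ,
                                 Equivalence.to (crossChild (≢-sym j≢i) p q) xy))

  modelIrrefl : ∀ (t : CM L) z → ¬ ModelAdj t z z
  modelIrrefl (leaf a) z ()
  modelIrrefl (node C s k ts) (i , p) a =
    modelIrrefl (ts i) p (Equivalence.to (Root.sameChild C s k ts i p p) a)

  modelGuidance : ∀ h (t : CM L) → Depth≤ h t → (B : LeafSet t) → Guidance t B (h * (L + L))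
  modelGuidance h (leaf a) _ B = (λ _ → ∅ (leaf a)) , record { inside = λ _ _ () ; guide = λ _ _ _ () }
  modelGuidance zero (node C s k ts) () B
  modelGuidance (suc h) (node C s k ts) d B =
    Root.nodeGuidance C s k ts B (λ i → modelGuidance h (ts i) (d i) (λ q → B (i , q)))

open Model

adj⇒≢ : ∀ (G : Graph) {x y} → Adj G x y → x ≢ y
adj⇒≢ G {x} a refl with trans (sym a) (Graph.irrefl G x)
... | ()

module _ (G : Graph) (A B : Subset (Graph.n G)) (Q : V G → V G → Set)
         (select : ∀ x → x ∈ A → Σ (V G) λ y → y ∈ B × Q x y) where

  selectionFun : PartialFun G
  selectionFun x with x ∈? A
  ... | yes x∈A = just (proj₁ (select x x∈A))
  ... | no _ = nothing

  selectionFun-isFunction : IsFunctionFromTo G A B selectionFun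
  selectionFun-isFunction = defined , undefined
    where
    defined : ∀ x → x ∈ A → Σ (V G) λ y → selectionFun x ≡ just y × y ∈ B
    defined x x∈A with x ∈? A
    ... | yes x∈A′ = proj₁ (select x x∈A′) , refl , proj₁ (proj₂ (select x x∈A′))
    ... | no x∉A = ⊥-elim (x∉A x∈A)
    undefined : ∀ x → x ∉ A → selectionFun x ≡ nothing
    undefined x x∉A with x ∈? A
    ... | yes x∈A = ⊥-elim (x∉A x∈A)
    ... | no _ = refl

  selectionFun-sound : ∀ x y → selectionFun x ≡ just y → Q x y
  selectionFun-sound x y e with x ∈? A
  selectionFun-sound x .(proj₁ (select x x∈A)) refl | yes x∈A = proj₂ (proj₂ (select x x∈A))
  selectionFun-sound x y () | no _

module Transfer (G : Graph) {L : ℕ} (t : CM L) (φ : V G ↔ Leaf t)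
  (iff : ∀ x y → x ≢ y → (Adj G x y ⇔ ModelAdj t (Inverse.to φ x) (Inverse.to φ y))) where

  open Inverse φ using (to; from; strictlyInverseˡ; strictlyInverseʳ)

  -- both adjacencies are irreflexive, so the model agrees with G on all pairs
  adj⇔ : ∀ x y → Adj G x y ⇔ ModelAdj t (to x) (to y)
  adj⇔ x y with x ≟ y
  ... | no x≢y = iff x y x≢y
  ... | yes refl = mk⇔ (λ a → ⊥-elim (adj⇒≢ G a refl)) (λ a → ⊥-elim (modelIrrefl t (to x) a))

  pull : LeafSet t → Subset (Graph.n G)
  pull U = Vec.tabulate (λ v → U (to v))

  ∈-pull : ∀ U v → v ∈ pull U ⇔ U (to v) ≡ true
  ∈-pull U v = mk⇔ (λ m → trans (sym (lookup∘tabulate _ v)) ([]=⇒lookup m))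
                   (λ e → lookup⇒[]= v (pull U) (trans (lookup∘tabulate _ v) e))

  push : Subset (Graph.n G) → LeafSet t
  push S z = lookup S (from z)

  ∈-push : ∀ S v → v ∈ S → push S (to v) ≡ true
  ∈-push S v v∈S = subst (λ w → lookup S w ≡ true) (sym (strictlyInverseʳ v)) ([]=⇒lookup v∈S)

  push-∈ : ∀ S z → push S z ≡ true → from z ∈ S
  push-∈ S z = lookup⇒[]= (from z) S

  uniqueTransfer : ∀ x U z → UniqueNbr t (to x) U z →
                   UniqueNeighbourIn G x (pull U) (from z)
  uniqueTransfer x U z (Uz , xz , unique) =
    Equivalence.from (∈-pull U (from z)) (subst (λ w → U w ≡ true) (sym (strictlyInverseˡ z)) Uz) ,
    Equivalence.from (adj⇔ x (from z)) (subst (ModelAdj t (to x)) (sym (strictlyInverseˡ z)) xz) ,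
    λ w w∈U xw → trans (sym (strictlyInverseʳ w))
      (cong from (unique (to w) (Equivalence.to (∈-pull U w) w∈U) (Equivalence.to (adj⇔ x w) xw)))

  guidedFunction : ∀ {m} (A B : Subset (Graph.n G)) → Guidance t (push B) m →
                   (∀ x → x ∈ A → Σ (V G) λ y → y ∈ B × Adj G x y) →
                   Σ (PartialFun G) λ f → IsFunctionFromTo G A B f × Guidable G m f
  guidedFunction A B (𝒰 , 𝒰-guides) dominated =
    selectionFun G A B Q select , selectionFun-isFunction G A B Q select ,
    List.tabulate (λ j → pull (𝒰 j)) , ≤-reflexive (length-tabulate _) ,
    λ x y e _ → let (j , unique) = selectionFun-sound G A B Q select x y e in tabulate⁺ j unique
    where
    Q : V G → V G → Set
    Q x y = Σ (Fin _) λ j → UniqueNeighbourIn G x (pull (𝒰 j)) y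

    select : ∀ x → x ∈ A → Σ (V G) λ y → y ∈ B × Q x y
    select x x∈A with dominated x x∈A
    ... | y , y∈B , xy
      with Guides.guide 𝒰-guides (to x) (to y) (∈-push B y y∈B) (Equivalence.to (adj⇔ x y) xy)
    ... | j , z , unique =
      from z , push-∈ B z (Guides.inside 𝒰-guides j z (proj₁ unique)) ,
      j , uniqueTransfer x (𝒰 j) z unique

-- With models of depth ≤ h over L labels, p = h·2L works: push B into the
-- model, take its guidance family, and transport it back to G.
lemma29 : ∀ {ℓ} (𝒞 : Graph → Set ℓ) → BoundedShrubdepth 𝒞 →
    Σ ℕ λ p → ∀ (G : Graph) → 𝒞 G →
    (A B : Subset (Graph.n G)) →
    (∀ x → x ∈ A → x ∉ B) →
    (∀ x → x ∈ A → Σ (V G) λ y → y ∈ B × Adj G x y) →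
    Σ (PartialFun G) λ f → IsFunctionFromTo G A B f × Guidable G p f
lemma29 𝒞 (h , L , models) = h * (L + L) , λ G G∈𝒞 A B _ dominated →
  let (t , depth , φ , iff) = models G G∈𝒞
  in Transfer.guidedFunction G t φ iff A B
       (modelGuidance h t depth (Transfer.push G t φ iff B)) dominated
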